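{- For deterministic comparison-based algorithms, finding the minimum of an input sequence has fragile complexity $\Theta(\log(\mathrm{Runs}))$, where $\mathrm{Runs}$ is the number of runs of the input.
   Context: A run of a sequence is a maximal consecutive ascending subsequence; $\mathrm{Runs}$ is the number of runs. The fragile complexity of an algorithm is the maximum, over input elements, of the number of comparisons in which the element participates; the problem has fragile complexity $\Theta(g)$ if some algorithm achieves fragile complexity $O(g)$ on all inputs with the given parameter value and every algorithm has fragile complexity $\Omega(g)$ on some such input. -}

module Defs where

open import Data.Nat using (ℕ; zero; suc; _+_; _*_; _≤_; _<_; _<ᵇ_; _⊔_)
open import Data.Bool using (Bool; true; false; if_then_else_)
open import Data.Fin using (Fin; zero; suc; inject₁) renaming (_≟_ to _≟F_)
open import Data.List using (List; foldr; map)
open import Data.List.Base using (allFin)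
open import Data.Sum using (_⊎_)
open import Relation.Nullary using (yes; no)
open import Relation.Nullary.Decidable using (⌊_⌋)
open import Relation.Binary.PropositionalEquality using (_≡_)
open import Function.Definitions using (Injective)

Input : ℕ → Set
Input n = Fin n → ℕ

Distinct : ∀ {n} → Input n → Set
Distinct {n} x = Injective _≡_ _≡_ x

-- Number of runs (maximal consecutive ascending blocks) of a nonempty sequence:
-- position 0 starts a run, and position i+1 starts a new run exactly when
-- x (i+1) < x i (the ascending block through i cannot be extended).
runStarts : ∀ n → Input (suc n) → ℕ
runStarts zero    x = 1
runStarts (suc n) x =
  runStarts n (λ i → x (inject₁ i))
  + (if x (Data.Fin.fromℕ (suc n)) <ᵇ x (inject₁ (Data.Fin.fromℕ n)) then 1 else 0)

Runs : ∀ {n} → Input (suc n) → ℕ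
Runs {n} x = runStarts n x

-- A deterministic comparison-based algorithm on inputs of length n is a
-- (finite) binary decision tree: an internal node compares the elements at
-- positions i and j and continues in the first subtree if x i < x j, in the
-- second otherwise; a leaf outputs a position (the claimed minimum).
data Tree (n : ℕ) : Set where
  leaf : Fin n → Tree n
  cmp  : Fin n → Fin n → Tree n → Tree n → Tree n

run : ∀ {n} → Tree n → Input n → Fin n
run (leaf k)       x = k
run (cmp i j l r)  x = if x i <ᵇ x j then run l x else run r x

FindsMin : ∀ {n} → Tree n → Set
FindsMin {n} T = (x : Input n) → Distinct x → (j : Fin n) → x (run T x) ≤ x j

involves : ∀ {n} → Fin n → Fin n → Fin n → ℕ
involves k i j = if ⌊ k ≟F i ⌋ then 1 else (if ⌊ k ≟F j ⌋ then 1 else 0)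

participation : ∀ {n} → Tree n → Input n → Fin n → ℕ
participation (leaf _)      x k = 0
participation (cmp i j l r) x k =
  involves k i j + (if x i <ᵇ x j then participation l x k else participation r x k)

fragile : ∀ {n} → Tree n → Input n → ℕ
fragile {n} T x = foldr _⊔_ 0 (map (participation T x) (allFin n))

-- Upper bound: the minimum starts a run, so it is among the run heads found
-- by comparing every adjacent pair once (at most two comparisons per
-- element); a knockout tournament among the Runs heads then costs each
-- element O(log Runs) further comparisons.
--
-- Lower bound: an adversary gives every candidate for the minimum a weight;
-- when two candidates meet, the lighter one loses and its weight passes to
-- the winner, so a candidate's weight never exceeds 2 ^ (its comparisons).
-- A correct algorithm must end with a single candidate, its output, which
-- then carries the whole initial weight.  With the even positions of a
-- sequence of length 2q + 1 as candidates of weight 1 and the odd positions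
-- fixed above everything else, every resulting input has q + 1 runs, and the
-- output takes part in at least log₂ (q + 1) comparisons.
module Submission where

open import Defs
open import Data.Bool using (Bool; true; false; if_then_else_; not; T)
open import Data.Bool.Properties using (not-involutive)
open import Data.Fin using (Fin; zero; suc; inject₁; fromℕ; toℕ; _≟_)
open import Data.Fin.Properties
  using (fromℕ≢inject₁; inject₁-injective; toℕ-injective; toℕ-inject₁; toℕ-fromℕ; toℕ<n)
  renaming (suc-injective to Fin-suc-injective)
open import Data.Fin.Relation.Unary.Top using (view; ‵fromℕ; ‵inject₁)
open import Data.List using (List; []; _∷_; map; length; foldr; allFin)
open import Data.List.Membership.Propositional using (_∈_)
open import Data.List.Membership.Propositional.Properties using (∈-map⁺; ∈-allFin)
open import Data.List.Relation.Unary.Any using (here; there)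
open import Data.Nat using (ℕ; zero; suc; _+_; _*_; _^_; _≤_; _<_; _≥_; _<ᵇ_; _⊔_; z≤n; s≤s; s≤s⁻¹; _≤?_)
open import Data.Nat.Properties hiding (_≟_)
open import Data.Nat.Tactic.RingSolver using (solve-∀)
open import Data.Nat.Logarithm using (⌊log₂_⌋; ⌊log₂⌋-mono-≤; ⌊log₂[2^n]⌋≡n)
open import Data.Product using (Σ; ∃; ∃₂; _×_; _,_; proj₁; proj₂)
open import Data.Sum using (_⊎_; inj₁; inj₂)
open import Function using (_∘_; const)
open import Data.Vec.Functional using (updateAt)
open import Data.Vec.Functional.Properties using (updateAt-updates; updateAt-minimal)
open import Relation.Nullary using (yes; no; contradiction)
open import Relation.Nullary.Decidable using (⌊_⌋)
open import Relation.Binary.PropositionalEquality using (_≡_; _≢_; refl; sym; trans; cong; cong₂; subst; module ≡-Reasoning)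

<ᵇ≡true⇒< : ∀ {m n} → (m <ᵇ n) ≡ true → m < n
<ᵇ≡true⇒< {m} {n} eq = <ᵇ⇒< m n (subst T (sym eq) _)

<ᵇ≡false⇒≥ : ∀ {m n} → (m <ᵇ n) ≡ false → n ≤ m
<ᵇ≡false⇒≥ eq = ≮⇒≥ λ m<n → subst T eq (<⇒<ᵇ m<n)

<⇒<ᵇ≡true : ∀ {m n} → m < n → (m <ᵇ n) ≡ true
<⇒<ᵇ≡true {m} {n} m<n with m <ᵇ n | <⇒<ᵇ m<n
... | true | _ = refl

≥⇒<ᵇ≡false : ∀ {m n} → n ≤ m → (m <ᵇ n) ≡ false
≥⇒<ᵇ≡false {m} {n} n≤m with m <ᵇ n in eq
... | true  = contradiction n≤m (<⇒≱ (<ᵇ≡true⇒< eq))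
... | false = refl

≤2^[⌊log₂⌋+1] : ∀ r → r ≤ 2 ^ (⌊log₂ r ⌋ + 1)
≤2^[⌊log₂⌋+1] r = ≮⇒≥ λ 2^e<r → m+1+n≰m ⌊log₂ r ⌋ (begin
  ⌊log₂ r ⌋ + 1             ≡⟨ ⌊log₂[2^n]⌋≡n (⌊log₂ r ⌋ + 1) ⟨
  ⌊log₂ 2 ^ (⌊log₂ r ⌋ + 1) ⌋ ≤⟨ ⌊log₂⌋-mono-≤ (<⇒≤ 2^e<r) ⟩
  ⌊log₂ r ⌋                 ∎)
  where open ≤-Reasoning

≤2^⇒⌊log₂⌋≤ : ∀ {r p} → r ≤ 2 ^ p → ⌊log₂ r ⌋ ≤ p
≤2^⇒⌊log₂⌋≤ {r} {p} r≤2^p = subst (⌊log₂ r ⌋ ≤_) (⌊log₂[2^n]⌋≡n p) (⌊log₂⌋-mono-≤ r≤2^p)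

≟-refl : ∀ {n} (a : Fin n) → ⌊ a ≟ a ⌋ ≡ true
≟-refl a with a ≟ a
... | yes _   = refl
... | no a≢a = contradiction refl a≢a

≟-≢ : ∀ {n} {a b : Fin n} → a ≢ b → ⌊ a ≟ b ⌋ ≡ false
≟-≢ {a = a} {b} a≢b with a ≟ b
... | yes a≡b = contradiction a≡b a≢b
... | no _    = refl

≟-inject₁ : ∀ {n} (k a : Fin n) → ⌊ inject₁ k ≟ inject₁ a ⌋ ≡ ⌊ k ≟ a ⌋
≟-inject₁ k a with k ≟ a
... | yes refl = ≟-refl (inject₁ k)
... | no k≢a   = ≟-≢ (k≢a ∘ inject₁-injective)

involves-first : ∀ {n} (i j : Fin n) → involves i i j ≡ 1
involves-first i j rewrite ≟-refl i = refl

involves-second : ∀ {n} (i j : Fin n) → involves j i j ≡ 1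
involves-second i j with ⌊ j ≟ i ⌋
... | true  = refl
... | false rewrite ≟-refl j = refl

fragile-lub : ∀ {n} (t : Tree n) x {B} → (∀ k → participation t x k ≤ B) → fragile t x ≤ B
fragile-lub {n} t x {B} bounded = go (allFin n)
  where
  go : ∀ ks → foldr _⊔_ 0 (map (participation t x) ks) ≤ B
  go []       = z≤n
  go (k ∷ ks) = ⊔-lub (bounded k) (go ks)

participation≤fragile : ∀ {n} (t : Tree n) x k → participation t x k ≤ fragile t x
participation≤fragile {n} t x k = go (∈-allFin k)
  where
  go : ∀ {ks} → k ∈ ks → participation t x k ≤ foldr _⊔_ 0 (map (participation t x) ks)
  go (here refl)  = m≤m⊔n _ _
  go (there k∈ks) = ≤-trans (go k∈ks) (m≤n⊔m _ _)

δ : ∀ {n} → Fin n → Fin n → ℕ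
δ k a = if ⌊ k ≟ a ⌋ then 1 else 0

δ≤1 : ∀ {n} (k a : Fin n) → δ k a ≤ 1
δ≤1 k a with ⌊ k ≟ a ⌋
... | true  = ≤-refl
... | false = z≤n

δ≤involves : ∀ {n} (k a b : Fin n) → δ k a ≤ involves k a b
δ≤involves k a b with ⌊ k ≟ a ⌋
... | true  = ≤-refl
... | false = z≤n

involves≤δ+δ : ∀ {n} (k a b : Fin n) → involves k a b ≤ δ k a + δ k b
involves≤δ+δ k a b with ⌊ k ≟ a ⌋
... | true  = s≤s z≤n
... | false = ≤-refl

inject₁² : ∀ {N} → Fin N × Fin N → Fin (suc N) × Fin (suc N)
inject₁² (a , b) = inject₁ a , inject₁ b

involvement : ∀ {N} → List (Fin N × Fin N) → Fin N → ℕ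
involvement []             k = 0
involvement ((a , b) ∷ ps) k = involves k a b + involvement ps k

lessCount : ∀ {N} → List (Fin N × Fin N) → Input N → ℕ
lessCount []             x = 0
lessCount ((a , b) ∷ ps) x = (if x a <ᵇ x b then 1 else 0) + lessCount ps x

involvement-inject₁ : ∀ {N} (ps : List (Fin N × Fin N)) k → involvement (map inject₁² ps) (inject₁ k) ≡ involvement ps k
involvement-inject₁ []             k = refl
involvement-inject₁ ((a , b) ∷ ps) k rewrite ≟-inject₁ k a | ≟-inject₁ k b =
  cong (involves k a b +_) (involvement-inject₁ ps k)

involvement-inject₁-fromℕ : ∀ {N} (ps : List (Fin N × Fin N)) → involvement (map inject₁² ps) (fromℕ N) ≡ 0
involvement-inject₁-fromℕ []             = refl
involvement-inject₁-fromℕ ((a , b) ∷ ps)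
  rewrite ≟-≢ (fromℕ≢inject₁ {i = a}) | ≟-≢ (fromℕ≢inject₁ {i = b}) = involvement-inject₁-fromℕ ps

lessCount-inject₁ : ∀ {N} (ps : List (Fin N × Fin N)) (x : Input (suc N)) →
  lessCount (map inject₁² ps) x ≡ lessCount ps (x ∘ inject₁)
lessCount-inject₁ []             x = refl
lessCount-inject₁ ((a , b) ∷ ps) x = cong (_ +_) (lessCount-inject₁ ps x)

-- The pairs (i + 1 , i); x (i + 1) < x i says that position i + 1 starts a run.
adjacentPairs : ∀ n → List (Fin (suc n) × Fin (suc n))
adjacentPairs zero    = []
adjacentPairs (suc n) = (fromℕ (suc n) , inject₁ (fromℕ n)) ∷ map inject₁² (adjacentPairs n)

involvement-adjacentPairs-last : ∀ n → involvement (adjacentPairs n) (fromℕ n) ≤ 1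
involvement-adjacentPairs-last zero = z≤n
involvement-adjacentPairs-last (suc n)
  rewrite ≟-refl (fromℕ (suc n)) | involvement-inject₁-fromℕ (adjacentPairs n) = ≤-refl

involvement-adjacentPairs : ∀ n k → involvement (adjacentPairs n) k ≤ 2
involvement-adjacentPairs zero    k = z≤n
involvement-adjacentPairs (suc n) k with view k
... | ‵fromℕ = ≤-trans (involvement-adjacentPairs-last (suc n)) (s≤s z≤n)
... | ‵inject₁ k′ rewrite ≟-≢ (fromℕ≢inject₁ {i = k′} ∘ sym) | involvement-inject₁ (adjacentPairs n) k′
                        | ≟-inject₁ k′ (fromℕ n) with k′ ≟ fromℕ n
...   | yes refl = s≤s (involvement-adjacentPairs-last n)
...   | no _     = involvement-adjacentPairs n k′

runStarts≡1+lessCount : ∀ n (x : Input (suc n)) → runStarts n x ≡ suc (lessCount (adjacentPairs n) x)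
runStarts≡1+lessCount zero    x = refl
runStarts≡1+lessCount (suc n) x = begin
  runStarts n (x ∘ inject₁) + d                        ≡⟨ cong (_+ d) (runStarts≡1+lessCount n (x ∘ inject₁)) ⟩
  suc (lessCount (adjacentPairs n) (x ∘ inject₁) + d)  ≡⟨ cong suc (+-comm _ d) ⟩
  suc (d + lessCount (adjacentPairs n) (x ∘ inject₁))
    ≡⟨ cong (λ c → suc (d + c)) (lessCount-inject₁ (adjacentPairs n) x) ⟨
  suc (lessCount (adjacentPairs (suc n)) x)            ∎
  where
  open ≡-Reasoning
  d : ℕ
  d = if x (fromℕ (suc n)) <ᵇ x (inject₁ (fromℕ n)) then 1 else 0

RunHead : ∀ n → Input (suc n) → Fin (suc n) → Set
RunHead n x h = h ≡ zero ⊎ ∃ λ b → (h , b) ∈ adjacentPairs n × (x h <ᵇ x b) ≡ true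

RunHead-inject₁ : ∀ n (x : Input (suc (suc n))) {h} → RunHead n (x ∘ inject₁) h → RunHead (suc n) x (inject₁ h)
RunHead-inject₁ n x (inj₁ refl)              = inj₁ refl
RunHead-inject₁ n x (inj₂ (b , hb∈ , h<b)) = inj₂ (inject₁ b , there (∈-map⁺ inject₁² hb∈) , h<b)

-- Walking left from j while the values decrease ends at the start of j's run.
run-head-below : ∀ n (x : Input (suc n)) j → ∃ λ h → RunHead n x h × x h ≤ x j
run-head-below zero    x zero = zero , inj₁ refl , ≤-refl
run-head-below (suc n) x j with view j
... | ‵inject₁ j′ with run-head-below n (x ∘ inject₁) j′
...   | h , head , h≤j = inject₁ h , RunHead-inject₁ n x head , h≤j
run-head-below (suc n) x j | ‵fromℕ with x (fromℕ (suc n)) <ᵇ x (inject₁ (fromℕ n)) in descent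
...   | true  = fromℕ (suc n) , inj₂ (_ , here refl , descent) , ≤-refl
...   | false with run-head-below n (x ∘ inject₁) (fromℕ n)
...     | h , head , h≤ = inject₁ h , RunHead-inject₁ n x head , ≤-trans h≤ (<ᵇ≡false⇒≥ descent)

winner≤ : ∀ {n} (x : Input n) a b → x (if x a <ᵇ x b then a else b) ≤ x a × x (if x a <ᵇ x b then a else b) ≤ x b
winner≤ x a b with x a <ᵇ x b in a<b
... | true  = ≤-refl , <⇒≤ (<ᵇ≡true⇒< a<b)
... | false = <ᵇ≡false⇒≥ a<b , ≤-refl

module FindMin (n : ℕ) where

  Pos : Set
  Pos = Fin (suc n)

  occurrences : Pos → List Pos → ℕ
  occurrences k []      = 0
  occurrences k (a ∷ L) = δ k a + occurrences k L

  -- The fuel bounds the number of rounds; a round pairs off the list and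
  -- accumulates the pairwise winners in its second argument.
  mutual
    knockout : ℕ → List Pos → Tree (suc n)
    knockout _       []          = leaf zero
    knockout _       (a ∷ [])    = leaf a
    knockout zero    (a ∷ _ ∷ _) = leaf a
    knockout (suc f) (a ∷ b ∷ L) = round f (a ∷ b ∷ L) []

    round : ℕ → List Pos → List Pos → Tree (suc n)
    round f []          W = knockout f W
    round f (a ∷ [])    W = knockout f (a ∷ W)
    round f (a ∷ b ∷ L) W = cmp a b (round f L (a ∷ W)) (round f L (b ∷ W))

  winners : List Pos → List Pos → Input (suc n) → List Pos
  winners []          W x = W
  winners (a ∷ [])    W x = a ∷ W
  winners (a ∷ b ∷ L) W x = winners L ((if x a <ᵇ x b then a else b) ∷ W) x

  round-run : ∀ f L W x → run (round f L W) x ≡ run (knockout f (winners L W x)) x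
  round-run f []          W x = refl
  round-run f (a ∷ [])    W x = refl
  round-run f (a ∷ b ∷ L) W x with x a <ᵇ x b
  ... | true  = round-run f L (a ∷ W) x
  ... | false = round-run f L (b ∷ W) x

  round-participation : ∀ f L W x k →
    participation (round f L W) x k ≤ occurrences k L + participation (knockout f (winners L W x)) x k
  round-participation f []          W x k = ≤-refl
  round-participation f (a ∷ [])    W x k = m≤n+m _ _
  round-participation f (a ∷ b ∷ L) W x k =
    ≤-trans (+-mono-≤ (involves≤δ+δ k a b) (next (x a <ᵇ x b)))
            (≤-reflexive (rearrange (δ k a) (δ k b) (occurrences k L) _))
    where
    rearrange : ∀ p q r s → p + q + (r + s) ≡ p + (q + r) + s
    rearrange = solve-∀
    next : ∀ c → (if c then participation (round f L (a ∷ W)) x k else participation (round f L (b ∷ W)) x k)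
               ≤ occurrences k L + participation (knockout f (winners L ((if c then a else b) ∷ W) x)) x k
    next true  = round-participation f L (a ∷ W) x k
    next false = round-participation f L (b ∷ W) x k

  winners-length : ∀ L W x K → length L ≤ K + K → length (winners L W x) ≤ length W + K
  winners-length []          W x K       _ = m≤m+n _ _
  winners-length (a ∷ [])    W x (suc K) _ = ≤-trans (s≤s (m≤m+n _ K)) (≤-reflexive (sym (+-suc _ K)))
  winners-length (a ∷ b ∷ L) W x (suc K) (s≤s |L|+1≤) =
    ≤-trans (winners-length L _ x K (s≤s⁻¹ (subst (suc (length L) ≤_) (+-suc K K) |L|+1≤)))
            (≤-reflexive (sym (+-suc _ K)))

  winners-halve : ∀ L x e → length L ≤ 2 ^ suc e → length (winners L [] x) ≤ 2 ^ e
  winners-halve L x e |L|≤ =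
    winners-length L [] x (2 ^ e) (subst (length L ≤_) (cong (2 ^ e +_) (+-identityʳ _)) |L|≤)

  winners-occurrences : ∀ L W x k → occurrences k (winners L W x) ≤ occurrences k L + occurrences k W
  winners-occurrences []          W x k = ≤-refl
  winners-occurrences (a ∷ [])    W x k = ≤-reflexive (cong (_+ occurrences k W) (sym (+-identityʳ _)))
  winners-occurrences (a ∷ b ∷ L) W x k =
    ≤-trans (winners-occurrences L _ x k) (begin
      occurrences k L + (δ k c + occurrences k W)     ≡⟨ rearrange (occurrences k L) (δ k c) _ ⟩
      δ k c + occurrences k L + occurrences k W       ≤⟨ +-monoˡ-≤ _ (+-monoˡ-≤ _ (δ-winner (x a <ᵇ x b))) ⟩
      δ k a + δ k b + occurrences k L + occurrences k W ≡⟨ cong (_+ occurrences k W) (+-assoc (δ k a) _ _) ⟩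
      occurrences k (a ∷ b ∷ L) + occurrences k W     ∎)
    where
    open ≤-Reasoning
    c : Pos
    c = if x a <ᵇ x b then a else b
    rearrange : ∀ p q r → p + (q + r) ≡ q + p + r
    rearrange = solve-∀
    δ-winner : ∀ b′ → δ k (if b′ then a else b) ≤ δ k a + δ k b
    δ-winner true  = m≤m+n _ _
    δ-winner false = m≤n+m _ _

  winners-keep : ∀ L W x {h} → h ∈ W → h ∈ winners L W x
  winners-keep []          W x h∈W = h∈W
  winners-keep (a ∷ [])    W x h∈W = there h∈W
  winners-keep (a ∷ b ∷ L) W x h∈W = winners-keep L _ x (there h∈W)

  winners-dominate : ∀ L W x {h} → h ∈ L → ∃ λ h′ → h′ ∈ winners L W x × x h′ ≤ x h
  winners-dominate (a ∷ [])    W x (here refl) = a , here refl , ≤-refl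
  winners-dominate (a ∷ b ∷ L) W x (there (there h∈L)) = winners-dominate L _ x h∈L
  winners-dominate (a ∷ b ∷ L) W x (here refl)         = _ , winners-keep L _ x (here refl) , proj₁ (winner≤ x a b)
  winners-dominate (a ∷ b ∷ L) W x (there (here refl)) = _ , winners-keep L _ x (here refl) , proj₂ (winner≤ x a b)

  knockout-min : ∀ f (L : List Pos) (x : Input (suc n)) → length L ≤ 2 ^ f →
                 ∀ {h} → h ∈ L → x (run (knockout f L) x) ≤ x h
  knockout-min f       (a ∷ [])    x _       (here refl) = ≤-refl
  knockout-min zero    (a ∷ b ∷ L) x (s≤s ()) _
  knockout-min (suc f) (a ∷ b ∷ L) x |L|≤ h∈L with winners-dominate (a ∷ b ∷ L) [] x h∈L
  ... | h′ , h′∈W , h′≤h rewrite round-run f (a ∷ b ∷ L) [] x =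
    ≤-trans (knockout-min f (winners (a ∷ b ∷ L) [] x) x (winners-halve (a ∷ b ∷ L) x f |L|≤) h′∈W) h′≤h

  knockout-participation : ∀ f (L : List Pos) (x : Input (suc n)) k e → length L ≤ 2 ^ e →
    participation (knockout f L) x k ≤ occurrences k L * e
  knockout-participation f       []          x k e       _ = z≤n
  knockout-participation f       (a ∷ [])    x k e       _ = z≤n
  knockout-participation zero    (a ∷ b ∷ L) x k e       _ = z≤n
  knockout-participation (suc f) (a ∷ b ∷ L) x k zero    (s≤s ())
  knockout-participation (suc f) (a ∷ b ∷ L) x k (suc e) |L|≤ = begin
    participation (round f L₀ []) x k                      ≤⟨ round-participation f L₀ [] x k ⟩
    occ L₀ + participation (knockout f (winners L₀ [] x)) x k
      ≤⟨ +-monoʳ-≤ (occ L₀) (knockout-participation f (winners L₀ [] x) x k e (winners-halve L₀ x e |L|≤)) ⟩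
    occ L₀ + occ (winners L₀ [] x) * e                     ≤⟨ +-monoʳ-≤ (occ L₀) (*-monoˡ-≤ e occ-winners) ⟩
    occ L₀ + occ L₀ * e                                    ≡⟨ *-suc (occ L₀) e ⟨
    occ L₀ * suc e                                          ∎
    where
    open ≤-Reasoning
    L₀ : List Pos
    L₀ = a ∷ b ∷ L
    occ : List Pos → ℕ
    occ = occurrences k
    occ-winners : occ (winners L₀ [] x) ≤ occ L₀
    occ-winners = ≤-trans (winners-occurrences L₀ [] x k) (≤-reflexive (+-identityʳ _))

  knockoutAll : List Pos → Tree (suc n)
  knockoutAll L = knockout (⌊log₂ length L ⌋ + 1) L

  knockoutAll-min : ∀ L x {h} → h ∈ L → x (run (knockoutAll L) x) ≤ x h
  knockoutAll-min L x = knockout-min _ L x (≤2^[⌊log₂⌋+1] (length L))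

  scan : List (Pos × Pos) → List Pos → Tree (suc n)
  scan []             H = knockoutAll H
  scan ((a , b) ∷ ps) H = cmp a b (scan ps (a ∷ H)) (scan ps H)

  collected : List (Pos × Pos) → List Pos → Input (suc n) → List Pos
  collected []             H x = H
  collected ((a , b) ∷ ps) H x = collected ps (if x a <ᵇ x b then a ∷ H else H) x

  scan-run : ∀ ps H x → run (scan ps H) x ≡ run (knockoutAll (collected ps H x)) x
  scan-run []             H x = refl
  scan-run ((a , b) ∷ ps) H x with x a <ᵇ x b
  ... | true  = scan-run ps (a ∷ H) x
  ... | false = scan-run ps H x

  scan-participation : ∀ ps H x k → participation (scan ps H) x k
    ≡ involvement ps k + participation (knockoutAll (collected ps H x)) x k
  scan-participation []             H x k = refl
  scan-participation ((a , b) ∷ ps) H x k with x a <ᵇ x b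
  ... | true  = trans (cong (involves k a b +_) (scan-participation ps (a ∷ H) x k)) (sym (+-assoc (involves k a b) _ _))
  ... | false = trans (cong (involves k a b +_) (scan-participation ps H x k)) (sym (+-assoc (involves k a b) _ _))

  collected-keep : ∀ ps H x {h} → h ∈ H → h ∈ collected ps H x
  collected-keep []             H x h∈H = h∈H
  collected-keep ((a , b) ∷ ps) H x h∈H with x a <ᵇ x b
  ... | true  = collected-keep ps (a ∷ H) x (there h∈H)
  ... | false = collected-keep ps H x h∈H

  collected-add : ∀ ps H x {a b} → (a , b) ∈ ps → (x a <ᵇ x b) ≡ true → a ∈ collected ps H x
  collected-add ((a , b) ∷ ps) H x (here refl) a<b rewrite a<b = collected-keep ps (a ∷ H) x (here refl)
  collected-add (_ ∷ ps)       H x (there ab∈) a<b = collected-add ps _ x ab∈ a<b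

  collected-length : ∀ ps H x → length (collected ps H x) ≡ length H + lessCount ps x
  collected-length []             H x = sym (+-identityʳ _)
  collected-length ((a , b) ∷ ps) H x with x a <ᵇ x b
  ... | true  = trans (collected-length ps (a ∷ H) x) (sym (+-suc _ _))
  ... | false = collected-length ps H x

  collected-occurrences : ∀ ps H x k → occurrences k (collected ps H x) ≤ occurrences k H + involvement ps k
  collected-occurrences []             H x k = m≤m+n _ _
  collected-occurrences ((a , b) ∷ ps) H x k with x a <ᵇ x b
  ... | true  = ≤-trans (collected-occurrences ps (a ∷ H) x k)
                        (≤-trans (+-monoˡ-≤ _ (+-monoˡ-≤ _ (δ≤involves k a b)))
                                 (≤-reflexive (rearrange (involves k a b) _ _)))
    where
    rearrange : ∀ p q r → p + q + r ≡ q + (p + r)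
    rearrange = solve-∀
  ... | false = ≤-trans (collected-occurrences ps H x k) (+-monoʳ-≤ (occurrences k H) (m≤n+m _ (involves k a b)))

  findMin : Tree (suc n)
  findMin = scan (adjacentPairs n) (zero ∷ [])

  heads : Input (suc n) → List Pos
  heads = collected (adjacentPairs n) (zero ∷ [])

  RunHead⇒∈heads : ∀ x {h} → RunHead n x h → h ∈ heads x
  RunHead⇒∈heads x (inj₁ refl)              = collected-keep (adjacentPairs n) _ x (here refl)
  RunHead⇒∈heads x (inj₂ (_ , hb∈ , h<b)) = collected-add (adjacentPairs n) _ x hb∈ h<b

  heads-length : ∀ x → length (heads x) ≡ Runs x
  heads-length x = trans (collected-length (adjacentPairs n) _ x) (sym (runStarts≡1+lessCount n x))

  findMin-correct : FindsMin findMin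
  findMin-correct x _ j with run-head-below n x j
  ... | h , head , h≤j rewrite scan-run (adjacentPairs n) (zero ∷ []) x =
    ≤-trans (knockoutAll-min (heads x) x (RunHead⇒∈heads x head)) h≤j

  findMin-participation : ∀ x k → participation findMin x k ≤ 5 * (⌊log₂ Runs x ⌋ + 1)
  findMin-participation x k = begin
    participation findMin x k
      ≡⟨ scan-participation (adjacentPairs n) _ x k ⟩
    involvement (adjacentPairs n) k + participation (knockout _ (heads x)) x k
      ≤⟨ +-mono-≤ (involvement-adjacentPairs n k) (knockout-participation _ (heads x) x k e heads≤2^e) ⟩
    2 + occurrences k (heads x) * e
      ≤⟨ +-monoʳ-≤ 2 (*-monoˡ-≤ e occurrences≤3) ⟩
    2 + 3 * e
      ≤⟨ +-monoˡ-≤ (3 * e) (*-monoʳ-≤ 2 (m≤n+m 1 ⌊log₂ Runs x ⌋)) ⟩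
    2 * e + 3 * e
      ≡⟨ *-distribʳ-+ e 2 3 ⟨
    5 * e ∎
    where
    open ≤-Reasoning
    e : ℕ
    e = ⌊log₂ Runs x ⌋ + 1
    heads≤2^e : length (heads x) ≤ 2 ^ e
    heads≤2^e = subst (_≤ 2 ^ e) (sym (heads-length x)) (≤2^[⌊log₂⌋+1] (Runs x))
    occurrences≤3 : occurrences k (heads x) ≤ 3
    occurrences≤3 = ≤-trans (collected-occurrences (adjacentPairs n) _ x k)
                            (+-mono-≤ (≤-trans (≤-reflexive (+-identityʳ _)) (δ≤1 k zero)) (involvement-adjacentPairs n k))

∑ : ∀ {N} → (Fin N → ℕ) → ℕ
∑ {zero}  f = 0
∑ {suc N} f = f zero + ∑ (f ∘ suc)

∑-cong : ∀ {N} {f g : Fin N → ℕ} → (∀ k → f k ≡ g k) → ∑ f ≡ ∑ g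
∑-cong {zero}  f≗g = refl
∑-cong {suc N} f≗g = cong₂ _+_ (f≗g zero) (∑-cong (f≗g ∘ suc))

∑-single : ∀ {N} (f : Fin N → ℕ) a → (∀ k → k ≢ a → f k ≡ 0) → ∑ f ≡ f a
∑-single {suc N} f zero    rest = trans (cong (f zero +_) (∑-zero (λ k → rest (suc k) λ ()))) (+-identityʳ _)
  where
  ∑-zero : ∀ {M} {g : Fin M → ℕ} → (∀ k → g k ≡ 0) → ∑ g ≡ 0
  ∑-zero {zero}  _  = refl
  ∑-zero {suc M} g0 = cong₂ _+_ (g0 zero) (∑-zero (g0 ∘ suc))
∑-single {suc N} f (suc a) rest =
  cong₂ _+_ (rest zero λ ()) (∑-single (f ∘ suc) a λ k k≢a → rest (suc k) (k≢a ∘ Fin-suc-injective))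


∑-update : ∀ {N} (f g : Fin N → ℕ) a → (∀ k → k ≢ a → g k ≡ f k) → ∑ g + f a ≡ ∑ f + g a
∑-update {suc N} f g zero agree = begin
  g zero + ∑ (g ∘ suc) + f zero  ≡⟨ cong (λ t → g zero + t + f zero) (∑-cong λ k → agree (suc k) λ ()) ⟩
  g zero + ∑ (f ∘ suc) + f zero  ≡⟨ swap (g zero) _ _ ⟩
  f zero + ∑ (f ∘ suc) + g zero  ∎
  where
  open ≡-Reasoning
  swap : ∀ p q r → p + q + r ≡ r + q + p
  swap = solve-∀
∑-update {suc N} f g (suc a) agree = begin
  g zero + ∑ (g ∘ suc) + f (suc a)    ≡⟨ +-assoc (g zero) _ _ ⟩
  g zero + (∑ (g ∘ suc) + f (suc a))
    ≡⟨ cong₂ _+_ (agree zero λ ()) (∑-update (f ∘ suc) (g ∘ suc) a λ k k≢a → agree (suc k) (k≢a ∘ Fin-suc-injective)) ⟩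
  f zero + (∑ (f ∘ suc) + g (suc a))  ≡⟨ +-assoc (f zero) _ _ ⟨
  f zero + ∑ (f ∘ suc) + g (suc a)    ∎
  where open ≡-Reasoning

∑-transfer : ∀ {N} (f g : Fin N → ℕ) {a b} → a ≢ b → g a ≡ f a + f b → g b ≡ 0 →
             (∀ k → k ≢ a → k ≢ b → g k ≡ f k) → ∑ g ≡ ∑ f
∑-transfer {suc N} f g {zero}  {zero}  a≢b _ _ _ = contradiction refl a≢b
∑-transfer {suc N} f g {zero}  {suc b} _ ga gb rest = begin
  g zero + ∑ (g ∘ suc)                   ≡⟨ cong (_+ ∑ (g ∘ suc)) ga ⟩
  f zero + f (suc b) + ∑ (g ∘ suc)       ≡⟨ rearrange (f zero) _ _ ⟩
  f zero + (∑ (g ∘ suc) + f (suc b))     ≡⟨ cong (f zero +_) tail ⟩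
  f zero + (∑ (f ∘ suc) + 0)             ≡⟨ cong (f zero +_) (+-identityʳ _) ⟩
  f zero + ∑ (f ∘ suc)                   ∎
  where
  open ≡-Reasoning
  rearrange : ∀ p q r → p + q + r ≡ p + (r + q)
  rearrange = solve-∀
  tail : ∑ (g ∘ suc) + f (suc b) ≡ ∑ (f ∘ suc) + 0
  tail = trans (∑-update (f ∘ suc) (g ∘ suc) b λ k k≢b → rest (suc k) (λ ()) (k≢b ∘ Fin-suc-injective))
               (cong (∑ (f ∘ suc) +_) gb)
∑-transfer {suc N} f g {suc a} {zero}  _ ga gb rest = begin
  g zero + ∑ (g ∘ suc)   ≡⟨ cong (_+ ∑ (g ∘ suc)) gb ⟩
  ∑ (g ∘ suc)            ≡⟨ +-cancelʳ-≡ (f (suc a)) _ _ tail ⟩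
  f zero + ∑ (f ∘ suc)   ∎
  where
  open ≡-Reasoning
  rearrange : ∀ p q r → p + (q + r) ≡ r + p + q
  rearrange = solve-∀
  tail : ∑ (g ∘ suc) + f (suc a) ≡ f zero + ∑ (f ∘ suc) + f (suc a)
  tail = trans (∑-update (f ∘ suc) (g ∘ suc) a λ k k≢a → rest (suc k) (k≢a ∘ Fin-suc-injective) (λ ()))
               (trans (cong (∑ (f ∘ suc) +_) ga) (rearrange (∑ (f ∘ suc)) (f (suc a)) (f zero)))
∑-transfer {suc N} f g {suc a} {suc b} a≢b ga gb rest =
  cong₂ _+_ (rest zero (λ ()) (λ ()))
            (∑-transfer (f ∘ suc) (g ∘ suc) (a≢b ∘ cong suc) ga gb
              λ k k≢a k≢b → rest (suc k) (k≢a ∘ Fin-suc-injective) (k≢b ∘ Fin-suc-injective))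

module Adversary (N : ℕ) where

  -- Elements still alive at the end of the play get values below M, and an
  -- element eliminated at a node of height h gets value M + h; heights
  -- decrease along the play, so later eliminations receive smaller values.
  M : ℕ
  M = suc N

  record State : Set where
    field
      alive  : Fin N → Bool
      weight : Fin N → ℕ
      value  : Fin N → ℕ
      cost   : Fin N → ℕ
  open State public

  liveWeight : State → Fin N → ℕ
  liveWeight s k = if alive s k then weight s k else 0

  totalWeight : State → ℕ
  totalWeight s = ∑ (liveWeight s)

  eliminate : State → (a b : Fin N) → ℕ → State
  eliminate s a b h = record s
    { alive  = updateAt (alive s) b (const false)
    ; weight = updateAt (weight s) a (_+ weight s b)
    ; value  = updateAt (value s) b (const (M + h))
    }

  charge : State → Fin N → Fin N → State
  charge s i j = record s { cost = λ k → cost s k + involves k i j }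

  data Settled (s : State) (i j : Fin N) : Bool → Set where
    same       : i ≡ j → Settled s i j false
    alive-dead : alive s i ≡ true → alive s j ≡ false → Settled s i j true
    dead-alive : alive s i ≡ false → alive s j ≡ true → Settled s i j false
    dead-dead  : alive s i ≡ false → alive s j ≡ false → Settled s i j (value s i <ᵇ value s j)

  data Step (s : State) (i j : Fin N) (h : ℕ) : Bool → State → Set where
    settled   : ∀ {b} → Settled s i j b → Step s i j h b s
    i-absorbs : i ≢ j → alive s i ≡ true → alive s j ≡ true → weight s j ≤ weight s i →
                Step s i j h true (eliminate s i j h)
    j-absorbs : i ≢ j → alive s i ≡ true → alive s j ≡ true → weight s i < weight s j →
                Step s i j h false (eliminate s j i h)

  respond : ∀ s i j h → ∃₂ (Step s i j h)
  respond s i j h with i ≟ j | alive s i in ai | alive s j in aj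
  ... | yes i≡j | _     | _     = false , s , settled (same i≡j)
  ... | no i≢j  | true  | true  with weight s j ≤? weight s i
  ...   | yes j≤i = true , eliminate s i j h , i-absorbs i≢j ai aj j≤i
  ...   | no j≰i  = false , eliminate s j i h , j-absorbs i≢j ai aj (≰⇒> j≰i)
  respond s i j h | no _ | true  | false = true , s , settled (alive-dead ai aj)
  respond s i j h | no _ | false | true  = false , s , settled (dead-alive ai aj)
  respond s i j h | no _ | false | false = (value s i <ᵇ value s j) , s , settled (dead-dead ai aj)

  height : Tree N → ℕ
  height (leaf _)      = 0
  height (cmp _ _ l r) = suc (height l ⊔ height r)

  height-left : ∀ i j l r → height l < height (cmp i j l r)
  height-left i j l r = s≤s (m≤m⊔n (height l) (height r))

  height-right : ∀ i j l r → height r < height (cmp i j l r)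
  height-right i j l r = s≤s (m≤n⊔m (height l) (height r))

  play : Tree N → State → State × Fin N
  play (leaf k)      s = s , k
  play (cmp i j l r) s with respond s i j (height (cmp i j l r))
  ... | true  , s′ , _ = play l (charge s′ i j)
  ... | false , s′ , _ = play r (charge s′ i j)

  final : Tree N → State → State
  final t s = proj₁ (play t s)

  output : Tree N → State → Fin N
  output t s = proj₂ (play t s)

  DeadAbove : ℕ → State → Set
  DeadAbove h s = ∀ k → alive s k ≡ false → M + h < value s k

  DeadInjective : State → Set
  DeadInjective s = ∀ k k′ → alive s k ≡ false → alive s k′ ≡ false → value s k ≡ value s k′ → k ≡ k′

  WeightBounded : State → Set
  WeightBounded s = ∀ k → alive s k ≡ true → weight s k ≤ 2 ^ cost s k

  Consistent : Input N → ℕ → State → Set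
  Consistent x h s = (∀ k → alive s k ≡ false → x k ≡ value s k) × (∀ k → alive s k ≡ true → x k ≤ M + h)

  DeadAbove-mono : ∀ {s d h} → d ≤ h → DeadAbove h s → DeadAbove d s
  DeadAbove-mono d≤h above k dead = ≤-<-trans (+-monoʳ-≤ M d≤h) (above k dead)

  Consistent-mono : ∀ {x s d h} → d ≤ h → Consistent x d s → Consistent x h s
  Consistent-mono d≤h (on-dead , on-alive) = on-dead , λ k live → ≤-trans (on-alive k live) (+-monoʳ-≤ M d≤h)

  eliminated : ∀ s a b h → alive (eliminate s a b h) b ≡ false × value (eliminate s a b h) b ≡ M + h
  eliminated s a b h = updateAt-updates b (alive s) , updateAt-updates b (value s)

  eliminate-other : ∀ s a b h {k} → k ≢ b →
    alive (eliminate s a b h) k ≡ alive s k × value (eliminate s a b h) k ≡ value s k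
  eliminate-other s a b h {k} k≢b = updateAt-minimal k b (alive s) k≢b , updateAt-minimal k b (value s) k≢b

  Consistent-eliminated : ∀ {x d} s a b h → Consistent x d (eliminate s a b h) → x b ≡ M + h
  Consistent-eliminated s a b h (on-dead , _) = let dead , value≡ = eliminated s a b h in trans (on-dead b dead) value≡

  eliminate-dead : ∀ s a b h {k} → alive (eliminate s a b h) k ≡ false →
    k ≡ b ⊎ (alive s k ≡ false × value (eliminate s a b h) k ≡ value s k)
  eliminate-dead s a b h {k} dead with k ≟ b
  ... | yes k≡b = inj₁ k≡b
  ... | no k≢b  = let alive≡ , value≡ = eliminate-other s a b h k≢b in inj₂ (trans (sym alive≡) dead , value≡)

  eliminate-DeadAbove : ∀ s a b {d h} → d < h → DeadAbove h s → DeadAbove d (eliminate s a b h)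
  eliminate-DeadAbove s a b {d} {h} d<h above k dead with eliminate-dead s a b h dead
  ... | inj₁ refl              = subst (M + d <_) (sym (proj₂ (eliminated s a b h))) (+-monoʳ-< M d<h)
  ... | inj₂ (dead-s , value≡) = subst (M + d <_) (sym value≡) (<-trans (+-monoʳ-< M d<h) (above k dead-s))

  eliminate-DeadInjective : ∀ s a b {h} → DeadAbove h s → DeadInjective s → DeadInjective (eliminate s a b h)
  eliminate-DeadInjective s a b {h} above inj k k′ dead dead′ same-value
    with eliminate-dead s a b h dead | eliminate-dead s a b h dead′
  ... | inj₁ refl         | inj₁ refl           = refl
  ... | inj₁ refl         | inj₂ (dead-s′ , v′) =
    contradiction (trans (sym (proj₂ (eliminated s a b h))) (trans same-value v′)) (<⇒≢ (above k′ dead-s′))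
  ... | inj₂ (dead-s , v) | inj₁ refl           =
    contradiction (trans (sym (proj₂ (eliminated s a b h))) (trans (sym same-value) v)) (<⇒≢ (above k dead-s))
  ... | inj₂ (dead-s , v) | inj₂ (dead-s′ , v′) = inj k k′ dead-s dead-s′ (trans (sym v) (trans same-value v′))

  eliminate-Consistent : ∀ s a b {x d h} → alive s b ≡ true → d ≤ h →
    Consistent x d (eliminate s a b h) → Consistent x h s
  eliminate-Consistent s a b {x} {d} {h} live-b d≤h (on-dead , on-alive) = on-dead′ , on-alive′
    where
    on-dead′ : ∀ k → alive s k ≡ false → x k ≡ value s k
    on-dead′ k dead with k ≟ b
    ... | yes refl = contradiction (trans (sym live-b) dead) λ ()
    ... | no k≢b   = let alive≡ , value≡ = eliminate-other s a b h k≢b in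
                     trans (on-dead k (trans alive≡ dead)) value≡
    on-alive′ : ∀ k → alive s k ≡ true → x k ≤ M + h
    on-alive′ k live with k ≟ b
    ... | yes refl = ≤-reflexive (Consistent-eliminated s a k h (on-dead , on-alive))
    ... | no k≢b   = ≤-trans (on-alive k (trans (proj₁ (eliminate-other s a b h k≢b)) live)) (+-monoʳ-≤ M d≤h)

  charge-WeightBounded : ∀ s i j → WeightBounded s → WeightBounded (charge s i j)
  charge-WeightBounded s i j bounded k live = ≤-trans (bounded k live) (^-monoʳ-≤ 2 (m≤m+n (cost s k) (involves k i j)))

  -- The winner at most doubles its weight, and takes part in the comparison.
  eliminate-WeightBounded : ∀ s a b h i j → a ≢ b → weight s b ≤ weight s a → involves a i j ≡ 1 →
    WeightBounded s → WeightBounded (charge (eliminate s a b h) i j)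
  eliminate-WeightBounded s a b h i j a≢b b≤a a∈ij bounded k live with k ≟ b
  ... | yes refl = contradiction (trans (sym live) (proj₁ (eliminated s a b h))) λ ()
  ... | no k≢b with k ≟ a
  ...   | yes refl = begin
    weight (eliminate s k b h) k       ≡⟨ updateAt-updates k (weight s) ⟩
    weight s k + weight s b            ≤⟨ +-mono-≤ ≤2^c (≤-trans b≤a ≤2^c) ⟩
    2 ^ cost s k + 2 ^ cost s k        ≡⟨ cong (2 ^ cost s k +_) (+-identityʳ _) ⟨
    2 ^ suc (cost s k)                 ≡⟨ cong (2 ^_) (trans (+-comm 1 (cost s k)) (cong (cost s k +_) (sym a∈ij))) ⟩
    2 ^ (cost s k + involves k i j)    ∎
    where
    open ≤-Reasoning
    ≤2^c : weight s k ≤ 2 ^ cost s k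
    ≤2^c = bounded k (trans (sym (proj₁ (eliminate-other s k b h k≢b))) live)
  ...   | no k≢a = ≤-trans (≤-reflexive (updateAt-minimal k a (weight s) k≢a))
                   (charge-WeightBounded s i j bounded k (trans (sym (proj₁ (eliminate-other s a b h k≢b))) live))

  eliminate-totalWeight : ∀ s a b h → a ≢ b → alive s a ≡ true → alive s b ≡ true →
    totalWeight (eliminate s a b h) ≡ totalWeight s
  eliminate-totalWeight s a b h a≢b live-a live-b = ∑-transfer (liveWeight s) (liveWeight s′) a≢b at-a at-b elsewhere
    where
    s′ : State
    s′ = eliminate s a b h
    at-a : liveWeight s′ a ≡ liveWeight s a + liveWeight s b
    at-a rewrite proj₁ (eliminate-other s a b h a≢b) | live-a | live-b = updateAt-updates a (weight s)
    at-b : liveWeight s′ b ≡ 0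
    at-b rewrite proj₁ (eliminated s a b h) = refl
    elsewhere : ∀ k → k ≢ a → k ≢ b → liveWeight s′ k ≡ liveWeight s k
    elsewhere k k≢a k≢b =
      cong₂ (λ c w → if c then w else 0) (proj₁ (eliminate-other s a b h k≢b)) (updateAt-minimal k a (weight s) k≢a)

  Consistent-alive< : ∀ {x d h s k} → Consistent x d s → d < h → alive s k ≡ true → x k < M + h
  Consistent-alive< (_ , on-alive) d<h live = ≤-<-trans (on-alive _ live) (+-monoʳ-< M d<h)

  Consistent-alive<dead : ∀ {x d h s k k′} → Consistent x d s → d < h → DeadAbove h s →
    alive s k ≡ true → alive s k′ ≡ false → x k < x k′
  Consistent-alive<dead {x} {s = s} {k′ = k′} consistent d<h above live dead =
    <-trans (Consistent-alive< {s = s} consistent d<h live) (subst (_ <_) (sym (proj₁ consistent k′ dead)) (above k′ dead))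

  Settled-answer : ∀ {s i j b x d h} → Settled s i j b → d < h → DeadAbove h s → Consistent x d s → (x i <ᵇ x j) ≡ b
  Settled-answer {i = i} {x = x} (same refl) _ _ _ = ≥⇒<ᵇ≡false {x i} ≤-refl
  Settled-answer {s} (alive-dead live dead) d<h above consistent =
    <⇒<ᵇ≡true (Consistent-alive<dead {s = s} consistent d<h above live dead)
  Settled-answer {s} (dead-alive dead live) d<h above consistent =
    ≥⇒<ᵇ≡false (<⇒≤ (Consistent-alive<dead {s = s} consistent d<h above live dead))
  Settled-answer (dead-dead dead dead′) _ _ (on-dead , _) = cong₂ _<ᵇ_ (on-dead _ dead) (on-dead _ dead′)

  step-answer : ∀ {s i j h b s′ x d} → Step s i j h b s′ → d < h → DeadAbove h s → Consistent x d s′ →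
                (x i <ᵇ x j) ≡ b
  step-answer (settled why) d<h above consistent = Settled-answer why d<h above consistent
  step-answer {s} {i} {j} {h} {x = x} (i-absorbs i≢j live _ _) d<h _ consistent =
    <⇒<ᵇ≡true (subst (x i <_) (sym (Consistent-eliminated s i j h consistent))
                (Consistent-alive< {s = eliminate s i j h} consistent d<h (trans (proj₁ (eliminate-other s i j h i≢j)) live)))
  step-answer {s} {i} {j} {h} {x = x} (j-absorbs i≢j _ live _) d<h _ consistent =
    ≥⇒<ᵇ≡false (<⇒≤ (subst (x j <_) (sym (Consistent-eliminated s j i h consistent))
                      (Consistent-alive< {s = eliminate s j i h} consistent d<h
                        (trans (proj₁ (eliminate-other s j i h (i≢j ∘ sym))) live))))

  step-Consistent : ∀ {s i j h b s′ x d} → Step s i j h b s′ → d ≤ h → Consistent x d s′ → Consistent x h s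
  step-Consistent {s}         (settled _)              d≤h = Consistent-mono {s = s} d≤h
  step-Consistent {s} {i} {j} (i-absorbs _ _ live-j _) d≤h = eliminate-Consistent s i j live-j d≤h
  step-Consistent {s} {i} {j} (j-absorbs _ live-i _ _) d≤h = eliminate-Consistent s j i live-i d≤h

  step-DeadAbove : ∀ {s i j h b s′ d} → Step s i j h b s′ → d < h → DeadAbove h s → DeadAbove d s′
  step-DeadAbove {s}         (settled _)         d<h = DeadAbove-mono {s} (<⇒≤ d<h)
  step-DeadAbove {s} {i} {j} (i-absorbs _ _ _ _) d<h = eliminate-DeadAbove s i j d<h
  step-DeadAbove {s} {i} {j} (j-absorbs _ _ _ _) d<h = eliminate-DeadAbove s j i d<h

  step-DeadInjective : ∀ {s i j h b s′} → Step s i j h b s′ → DeadAbove h s → DeadInjective s → DeadInjective s′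
  step-DeadInjective             (settled _)         _     inj = inj
  step-DeadInjective {s} {i} {j} (i-absorbs _ _ _ _) above     = eliminate-DeadInjective s i j above
  step-DeadInjective {s} {i} {j} (j-absorbs _ _ _ _) above     = eliminate-DeadInjective s j i above

  step-WeightBounded : ∀ {s i j h b s′} → Step s i j h b s′ → WeightBounded s → WeightBounded (charge s′ i j)
  step-WeightBounded {s} {i} {j} (settled _) = charge-WeightBounded s i j
  step-WeightBounded {s} {i} {j} {h} (i-absorbs i≢j _ _ j≤i) =
    eliminate-WeightBounded s i j h i j i≢j j≤i (involves-first i j)
  step-WeightBounded {s} {i} {j} {h} (j-absorbs i≢j _ _ i<j) =
    eliminate-WeightBounded s j i h i j (i≢j ∘ sym) (<⇒≤ i<j) (involves-second i j)

  step-totalWeight : ∀ {s i j h b s′} → Step s i j h b s′ → totalWeight s′ ≡ totalWeight s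
  step-totalWeight                 (settled _)                     = refl
  step-totalWeight {s} {i} {j} {h} (i-absorbs i≢j live-i live-j _) = eliminate-totalWeight s i j h i≢j live-i live-j
  step-totalWeight {s} {i} {j} {h} (j-absorbs i≢j live-i live-j _) = eliminate-totalWeight s j i h (i≢j ∘ sym) live-j live-i

  step-cost : ∀ {s i j h b s′} → Step s i j h b s′ → ∀ k → cost s′ k ≡ cost s k
  step-cost (settled _)         k = refl
  step-cost (i-absorbs _ _ _ _) k = refl
  step-cost (j-absorbs _ _ _ _) k = refl

  Preserved : (ℕ → State → Set) → Set
  Preserved P = ∀ {s i j h b s′ d} → Step s i j h b s′ → d < h → P h s → P d (charge s′ i j)

  play-preserves : ∀ {P} → Preserved P → ∀ t s → P (height t) s → P 0 (final t s)
  play-preserves pres (leaf _)      s p = p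
  play-preserves pres (cmp i j l r) s p with respond s i j (height (cmp i j l r))
  ... | true  , _ , step = play-preserves pres l _ (pres step (height-left i j l r) p)
  ... | false , _ , step = play-preserves pres r _ (pres step (height-right i j l r) p)

  step-charge : ∀ {s i j h b s′} → Step s i j h b s′ →
                ∀ P k → involves k i j + P + cost s k ≡ P + cost (charge s′ i j) k
  step-charge {s} {i} {j} step P k rewrite step-cost step k = rearrange (involves k i j) P (cost s k)
    where
    rearrange : ∀ p q r → p + q + r ≡ q + (r + p)
    rearrange = solve-∀

  replay : ∀ t s x → DeadAbove (height t) s → Consistent x 0 (final t s) →
    Consistent x (height t) s × run t x ≡ output t s × (∀ k → participation t x k + cost s k ≡ cost (final t s) k)
  replay (leaf _)      s x _     consistent = consistent , refl , λ _ → refl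
  replay (cmp i j l r) s x above consistent with respond s i j (height (cmp i j l r))
  ... | true , s′ , step with replay l (charge s′ i j) x (step-DeadAbove step (height-left i j l r) above) consistent
  ...   | consistent′ , run≡ , cost≡ rewrite step-answer step (height-left i j l r) above consistent′ =
    step-Consistent step (<⇒≤ (height-left i j l r)) consistent′ , run≡ ,
    λ k → trans (step-charge step (participation l x k) k) (cost≡ k)
  replay (cmp i j l r) s x above consistent | false , s′ , step
    with replay r (charge s′ i j) x (step-DeadAbove step (height-right i j l r) above) consistent
  ...   | consistent′ , run≡ , cost≡ rewrite step-answer step (height-right i j l r) above consistent′ =
    step-Consistent step (<⇒≤ (height-right i j l r)) consistent′ , run≡ ,
    λ k → trans (step-charge step (participation r x k) k) (cost≡ k)

  survivorValue : Fin N → Fin N → ℕ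
  survivorValue top k = if ⌊ k ≟ top ⌋ then 0 else suc (toℕ k)

  survivorValue<M : ∀ top k → survivorValue top k < M
  survivorValue<M top k with ⌊ k ≟ top ⌋
  ... | true  = s≤s z≤n
  ... | false = s≤s (toℕ<n k)

  survivorValue-injective : ∀ top {k k′} → survivorValue top k ≡ survivorValue top k′ → k ≡ k′
  survivorValue-injective top {k} {k′} eq with k ≟ top | k′ ≟ top
  ... | yes refl | yes refl = refl
  ... | no _     | no _     = toℕ-injective (suc-injective eq)
  ... | yes _    | no _     with () ← eq
  ... | no _     | yes _    with () ← eq

  survivorValue≡0 : ∀ top {k} → survivorValue top k ≡ 0 → k ≡ top
  survivorValue≡0 top {k} eq with k ≟ top
  ... | yes k≡top = k≡top
  ... | no _      with () ← eq

  survivorValue<dead : ∀ f top k {k′} → DeadAbove 0 f → alive f k′ ≡ false → survivorValue top k < value f k′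
  survivorValue<dead f top k {k′} above dead =
    <-trans (survivorValue<M top k) (subst (_< value f k′) (+-identityʳ M) (above k′ dead))

  input : State → Fin N → Input N
  input f top k = if alive f k then survivorValue top k else value f k

  input-Consistent : ∀ f top → Consistent (input f top) 0 f
  input-Consistent f top = on-dead , on-alive
    where
    on-dead : ∀ k → alive f k ≡ false → input f top k ≡ value f k
    on-dead k dead rewrite dead = refl
    on-alive : ∀ k → alive f k ≡ true → input f top k ≤ M + 0
    on-alive k live rewrite live | +-identityʳ M = <⇒≤ (survivorValue<M top k)

  input-Distinct : ∀ f top → DeadAbove 0 f → DeadInjective f → Distinct (input f top)
  input-Distinct f top above inj {k} {k′} eq with alive f k in a | alive f k′ in a′
  ... | true  | true  = survivorValue-injective top eq
  ... | false | false = inj k k′ a a′ eq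
  ... | true  | false = contradiction eq (<⇒≢ (survivorValue<dead f top k above a′))
  ... | false | true  = contradiction (sym eq) (<⇒≢ (survivorValue<dead f top k′ above a))

  input≡0 : ∀ f top {k} → DeadAbove 0 f → input f top k ≡ 0 → k ≡ top
  input≡0 f top {k} above eq with alive f k in a
  ... | true  = survivorValue≡0 top eq
  ... | false = contradiction eq (<⇒≢ (≤-<-trans z≤n (above k a)) ∘ sym)

  module Play (t : Tree N) (s : State) (above : DeadAbove (height t) s) (inj : DeadInjective s) where

    f : State
    f = final t s

    o : Fin N
    o = output t s

    final-DeadAbove×DeadInjective : DeadAbove 0 f × DeadInjective f
    final-DeadAbove×DeadInjective = play-preserves {λ h s′ → DeadAbove h s′ × DeadInjective s′}
      (λ step d<h (above′ , inj′) → step-DeadAbove step d<h above′ , step-DeadInjective step above′ inj′)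
      t s (above , inj)

    final-WeightBounded : WeightBounded s → WeightBounded f
    final-WeightBounded = play-preserves {λ _ → WeightBounded} (λ step _ → step-WeightBounded step) t s

    final-totalWeight : totalWeight f ≡ totalWeight s
    final-totalWeight = play-preserves {λ _ s′ → totalWeight s′ ≡ totalWeight s}
      (λ step _ eq → trans (step-totalWeight step) eq) t s refl

    final-input-Distinct : ∀ top → Distinct (input f top)
    final-input-Distinct top =
      input-Distinct f top (proj₁ final-DeadAbove×DeadInjective) (proj₂ final-DeadAbove×DeadInjective)

    replay-input : ∀ top → Consistent (input f top) (height t) s × run t (input f top) ≡ o
                         × (∀ k → participation t (input f top) k + cost s k ≡ cost f k)
    replay-input top = replay t s (input f top) above (input-Consistent f top)

    -- If k survived, the input giving k the least value makes the algorithm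
    -- answer o, so correctness forces o = k.
    survivor-is-output : FindsMin t → ∀ k → alive f k ≡ true → k ≡ o
    survivor-is-output correct k live = sym (input≡0 f k (proj₁ final-DeadAbove×DeadInjective) (n≤0⇒n≡0 yo≤0))
      where
      y : Input N
      y = input f k
      yk≡0 : y k ≡ 0
      yk≡0 rewrite live | ≟-refl k = refl
      yo≤0 : y o ≤ 0
      yo≤0 = subst (λ p → y p ≤ 0) (proj₁ (proj₂ (replay-input k)))
                   (subst (y (run t y) ≤_) yk≡0 (correct y (final-input-Distinct k) k))

    x : Input N
    x = input f o

    totalWeight≤2^fragile : FindsMin t → WeightBounded s → (∀ k → cost s k ≡ 0) → totalWeight s ≤ 2 ^ fragile t x
    totalWeight≤2^fragile correct bounded no-cost = begin
      totalWeight s            ≡⟨ final-totalWeight ⟨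
      totalWeight f            ≡⟨ ∑-single (liveWeight f) o only-o ⟩
      liveWeight f o           ≤⟨ liveWeight≤2^cost (alive f o) refl ⟩
      2 ^ cost f o             ≡⟨ cong (2 ^_) cost≡ ⟨
      2 ^ participation t x o  ≤⟨ ^-monoʳ-≤ 2 (participation≤fragile t x o) ⟩
      2 ^ fragile t x          ∎
      where
      open ≤-Reasoning
      only-o : ∀ k → k ≢ o → liveWeight f k ≡ 0
      only-o k k≢o with alive f k in live
      ... | true  = contradiction (survivor-is-output correct k live) k≢o
      ... | false = refl
      liveWeight≤2^cost : ∀ c → alive f o ≡ c → liveWeight f o ≤ 2 ^ cost f o
      liveWeight≤2^cost true  live rewrite live = final-WeightBounded bounded o live
      liveWeight≤2^cost false dead rewrite dead = z≤n
      cost≡ : participation t x o ≡ cost f o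
      cost≡ = trans (sym (trans (cong (participation t x o +_) (no-cost o)) (+-identityʳ _)))
                    (proj₂ (proj₂ (replay-input o)) o)

even : ℕ → Bool
even zero    = true
even (suc m) = not (even m)

double : ℕ → ℕ
double zero    = zero
double (suc q) = suc (suc (double q))

odds : ℕ → ℕ
odds zero    = 0
odds (suc m) = odds m + (if not (even m) then 1 else 0)

even-double : ∀ q → even (double q) ≡ true
even-double zero    = refl
even-double (suc q) = trans (not-involutive _) (even-double q)

odds-double : ∀ q → odds (double q) ≡ q
odds-double zero    = refl
odds-double (suc q) rewrite even-double q | odds-double q | +-identityʳ q = +-comm q 1

∑-evens : ∀ q → ∑ {suc (double q)} (λ k → if even (toℕ k) then 1 else 0) ≡ suc q
∑-evens zero    = refl
∑-evens (suc q) = cong suc (trans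
  (∑-cong {suc (double q)} λ k → cong (λ c → if c then 1 else 0) (not-involutive (even (toℕ k))))
  (∑-evens q))

runStarts-alternating : ∀ n (x : Input (suc n)) → (∀ i → (x (suc i) <ᵇ x (inject₁ i)) ≡ not (even (toℕ i))) →
                        runStarts n x ≡ suc (odds n)
runStarts-alternating zero    x _        = refl
runStarts-alternating (suc n) x descents = cong₂ _+_
  (runStarts-alternating n (x ∘ inject₁) λ i → trans (descents (inject₁ i)) (cong (not ∘ even) (toℕ-inject₁ i)))
  (cong (λ c → if c then 1 else 0) (trans (descents (fromℕ n)) (cong (not ∘ even) (toℕ-fromℕ n))))

-- Even positions start alive, odd positions start eliminated with values above
-- everything the play can assign, so every odd-to-even step is a descent
-- whatever the adversary does.
module Alternating (q : ℕ) (t : Tree (suc (double q))) where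
  open Adversary (suc (double q))

  initial : State
  initial = record
    { alive  = λ k → even (toℕ k)
    ; weight = λ _ → 1
    ; value  = λ k → suc (M + height t + toℕ k)
    ; cost   = λ _ → 0
    }

  initial-DeadAbove : DeadAbove (height t) initial
  initial-DeadAbove k _ = s≤s (m≤m+n _ (toℕ k))

  initial-DeadInjective : DeadInjective initial
  initial-DeadInjective k k′ _ _ eq = toℕ-injective (+-cancelˡ-≡ (M + height t) _ _ (suc-injective eq))

  initial-WeightBounded : WeightBounded initial
  initial-WeightBounded _ _ = ≤-refl

  open Play t initial initial-DeadAbove initial-DeadInjective public
    using (x; o; final-input-Distinct; replay-input; totalWeight≤2^fragile)

  even<odd : ∀ {k k′} → even (toℕ k) ≡ true → even (toℕ k′) ≡ false → x k < x k′
  even<odd {k} {k′} ek ek′ = ≤-<-trans (proj₂ consistent k ek)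
    (subst (M + height t <_) (sym (proj₁ consistent k′ ek′)) (s≤s (m≤m+n _ (toℕ k′))))
    where
    consistent : Consistent x (height t) initial
    consistent = proj₁ (replay-input o)

  descents : ∀ i → (x (suc i) <ᵇ x (inject₁ i)) ≡ not (even (toℕ i))
  descents i with even (toℕ i) in e
  ... | true  = ≥⇒<ᵇ≡false (<⇒≤ (even<odd (trans (cong even (toℕ-inject₁ i)) e) (cong not e)))
  ... | false = <⇒<ᵇ≡true (even<odd (cong not e) (trans (cong even (toℕ-inject₁ i)) e))

  runs : Runs x ≡ suc q
  runs = trans (runStarts-alternating (double q) x descents) (cong suc (odds-double q))

alternating-witness : ∀ q (t : Tree (suc (double q))) → FindsMin t →
  ∃ λ (x : Input (suc (double q))) → Distinct x × Runs x ≡ suc q × ⌊log₂ suc q ⌋ ≤ fragile t x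
alternating-witness q t correct = x , final-input-Distinct o , runs , ≤2^⇒⌊log₂⌋≤ (begin
  suc q                  ≡⟨ ∑-evens q ⟨
  totalWeight initial    ≤⟨ totalWeight≤2^fragile correct initial-WeightBounded (λ _ → refl) ⟩
  2 ^ fragile t x        ∎)
  where
  open Alternating q t
  open Adversary (suc (double q)) using (totalWeight)
  open ≤-Reasoning

theorem5 :
    (Σ ℕ λ c → Σ ((n : ℕ) → Tree (suc n)) λ A →
        ((n : ℕ) → FindsMin (A n))
      × ((n : ℕ) (x : Input (suc n)) → Distinct x →
           fragile (A n) x ≤ c * (⌊log₂ Runs x ⌋ + 1)))
    ×
    (Σ ℕ λ c → (A : (n : ℕ) → Tree (suc n)) → ((n : ℕ) → FindsMin (A n)) →
        (r : ℕ) → r ≥ 1 →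
        Σ ℕ λ n → Σ (Input (suc n)) λ x →
          Distinct x × Runs x ≡ r × ⌊log₂ r ⌋ ≤ c * fragile (A n) x)
theorem5 = (5 , findMin , findMin-correct , λ n x _ → fragile-lub (findMin n) x (findMin-participation n x))
         , (1 , lower)
  where
  open FindMin using (findMin; findMin-correct; findMin-participation)
  lower : (A : (n : ℕ) → Tree (suc n)) → ((n : ℕ) → FindsMin (A n)) → (r : ℕ) → r ≥ 1 →
          Σ ℕ λ n → Σ (Input (suc n)) λ x → Distinct x × Runs x ≡ r × ⌊log₂ r ⌋ ≤ 1 * fragile (A n) x
  lower A correct (suc q) _ with alternating-witness q (A (double q)) (correct (double q))
  ... | x , distinct , runs , log≤ = double q , x , distinct , runs , subst (_ ≤_) (sym (*-identityˡ _)) log≤
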